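{- Let $e_1,e_2,e_3$ be nonzero integers with $e_1+e_2+e_3=0$. Let $\Lambda=(d_1,d_2,d_3)$ be a triple of square-free integers with $d_1d_2d_3$ a square. Let $n$ be a positive square-free integer coprime with $e_1e_2e_3$ and $p$ an odd prime factor of $n$. Then $D_\Lambda^{(n)}(\mathbb Q_p)\neq\emptyset$ if and only if - $\left(\frac{d_1}p\right)=\left(\frac{d_2}p\right)=\left(\frac{d_3}p\right)=1$, if $p\nmid d_1d_2d_3$; - $\left(\frac{ -e_2e_3d_1}p\right)=\left(\frac{e_3n/d_2}p\right)=\left(\frac{ -e_2n/d_3}p\right)=1$, if $p\nmid d_1$, $p\mid d_2$, $p\mid d_3$; - $\left(\frac{ -e_3n/d_1}p\right)=\left(\frac{ -e_3e_1d_2}p\right)=\left(\frac{e_1n/d_3}p\right)=1$, if $p\mid d_1$, $p\nmid d_2$, $p\mid d_3$; - $\left(\frac{e_2n/d_1}p\right)=\left(\frac{ -e_1n/d_2}p\right)=\left(\frac{ -e_1e_2d_3}p\right)=1$, if $p\mid d_1$, $p\mid d_2$, $p\nmid d_3$.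
   Context: $D_\Lambda^{(n)}$ is the curve in $\mathbb P^3$ with coordinates $(t,u_1,u_2,u_3)$ defined by $e_1nt^2+d_2u_2^2-d_3u_3^2=0$, $e_2nt^2+d_3u_3^2-d_1u_1^2=0$, $e_3nt^2+d_1u_1^2-d_2u_2^2=0$. $\left(\frac{\cdot}{p}\right)$ is the Legendre symbol. -}

module Defs where

open import Data.Nat as ℕ using (ℕ; suc)
open import Data.Nat.Primality using (Prime)
open import Data.Nat.Divisibility using () renaming (_∣_ to _∣ℕ_)
open import Data.Nat.Coprimality using (Coprime)
open import Data.Integer as ℤ using (ℤ; +_; _+_; _-_; _*_; -_; ∣_∣)
open import Data.Integer.Divisibility using (_∣_)
open import Data.Product using (Σ; ∃; _×_)
open import Relation.Nullary using (¬_)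
open import Relation.Binary.PropositionalEquality using (_≡_)

-- A nonzero integer z is square-free: the only natural m with m² ∣ |z| is 1.
-- (For z = 0 this fails, so square-free integers are nonzero.)
SquareFree : ℤ → Set
SquareFree z = ∀ (m : ℕ) → (m ℕ.* m) ∣ℕ ∣ z ∣ → m ≡ 1

IsSquare : ℤ → Set
IsSquare z = ∃ λ m → z ≡ m * m

LegendreOne : ℕ → ℤ → Set
LegendreOne p a = (¬ (+ p ∣ a)) × (∃ λ x → + p ∣ (x * x - a))

-- Legendre symbol (a/b over p) = 1 for a rational a/b (b ≠ 0) which is a
-- p-adic unit: write a = p^v a', b = p^v b' with p ∤ a', p ∤ b'; then
-- (a/b / p) = (a'/p)(b'/p) = (a'b'/p).
LegendreOneFrac : ℕ → ℤ → ℤ → Set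
LegendreOneFrac p a b =
  Σ ℕ λ v → Σ ℤ λ a' → Σ ℤ λ b' →
    (a ≡ + (p ℕ.^ v) * a') × (b ≡ + (p ℕ.^ v) * b')
    × (¬ (+ p ∣ a')) × (¬ (+ p ∣ b')) × LegendreOne p (a' * b')

-- p-adic integers as the inverse limit of ℤ/p^k: approx k represents the
-- residue mod p^k, and consecutive approximations are compatible.
record ℤₚ (p : ℕ) : Set where
  field
    approx : ℕ → ℤ
    coh    : ∀ k → + (p ℕ.^ k) ∣ (approx (suc k) - approx k)
open ℤₚ public

F₁ F₂ F₃ : (e₁ e₂ e₃ d₁ d₂ d₃ : ℤ) (n : ℕ) (t u₁ u₂ u₃ : ℤ) → ℤ
F₁ e₁ e₂ e₃ d₁ d₂ d₃ n t u₁ u₂ u₃ = e₁ * + n * t * t + d₂ * u₂ * u₂ - d₃ * u₃ * u₃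
F₂ e₁ e₂ e₃ d₁ d₂ d₃ n t u₁ u₂ u₃ = e₂ * + n * t * t + d₃ * u₃ * u₃ - d₁ * u₁ * u₁
F₃ e₁ e₂ e₃ d₁ d₂ d₃ n t u₁ u₂ u₃ = e₃ * + n * t * t + d₁ * u₁ * u₁ - d₂ * u₂ * u₂

-- D_Λ^(n)(ℚ_p) ≠ ∅: after clearing denominators, a point of P^3(ℚ_p) is given
-- by a primitive vector (t,u1,u2,u3) ∈ ℤ_p^4 (not all coordinates divisible
-- by p), and it lies on the curve iff each F_i vanishes in ℤ_p, i.e. F_i of
-- the approximations is ≡ 0 mod p^k for every k.
HasQpPoint : (e₁ e₂ e₃ d₁ d₂ d₃ : ℤ) (n p : ℕ) → Set
HasQpPoint e₁ e₂ e₃ d₁ d₂ d₃ n p =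
  Σ (ℤₚ p) λ t → Σ (ℤₚ p) λ u₁ → Σ (ℤₚ p) λ u₂ → Σ (ℤₚ p) λ u₃ →
    (¬ ((+ p ∣ approx t 1) × (+ p ∣ approx u₁ 1) × (+ p ∣ approx u₂ 1) × (+ p ∣ approx u₃ 1)))
    × (∀ k → let T = approx t k ; U₁ = approx u₁ k ; U₂ = approx u₂ k ; U₃ = approx u₃ k in
         (+ (p ℕ.^ k) ∣ F₁ e₁ e₂ e₃ d₁ d₂ d₃ n T U₁ U₂ U₃)
       × (+ (p ℕ.^ k) ∣ F₂ e₁ e₂ e₃ d₁ d₂ d₃ n T U₁ U₂ U₃)
       × (+ (p ℕ.^ k) ∣ F₃ e₁ e₂ e₃ d₁ d₂ d₃ n T U₁ U₂ U₃))

{-# OPTIONS --safe #-}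
-- Since the dᵢ are square-free and d₁d₂d₃ is a square, p divides none or exactly two of the
-- dᵢ; up to a cyclic permutation of the indices this leaves two cases.
--
-- Necessity: reduce a primitive ℚ_p-point (t : u₁ : u₂ : u₃) modulo p². If p ∤ d₁d₂d₃, then
-- d₁u₁² ≡ d₂u₂² ≡ d₃u₃² mod p with u₁ a unit (otherwise p divides every coordinate), and
-- d₁(d₁u₁²)² ≡ d₁d₂d₃(u₂u₃)² exhibits d₁ as a square mod p. If dᵢ = bᵢp for i = 2, 3 and
-- n = n′p, then p ∣ u₁, and the last two equations divided by p read e₃n′t² ≡ b₂u₂² and
-- −e₂n′t² ≡ b₃u₃² with t a unit; so e₃n′b₂ and −e₂n′b₃ are squares mod p, and so is their
-- product times d₁², which is −e₂e₃d₁(n′r)² where r² = d₁b₂b₃.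
--
-- Sufficiency: for odd p, Hensel's lemma lifts the square roots mod p to ℤ_p, and explicit
-- points are (0 : √(d₂d₃) : √(d₃d₁) : √(d₁d₂)) and (b₂b₃ : 0 : b₃√(a₂b₂) : b₂√(a₃b₃)).
module Submission where

open import Defs
open import Data.Nat as ℕ using (ℕ; suc; zero)
import Data.Nat.Properties as ℕ
open import Data.Nat.Primality using (Prime; euclidsLemma; prime⇒nonZero; prime⇒nonTrivial; prime⇒irreducible; irreducible[2])
open import Data.Nat.Divisibility using () renaming (_∣_ to _∣ℕ_)
open import Data.Nat.Coprimality using (Coprime; coprime-Bézout)
open import Data.Nat.GCD using (module Bézout)
open import Data.Integer as ℤ using (ℤ; +_; _+_; _-_; _*_; -_; ∣_∣)
import Data.Integer.Properties as ℤ
open import Data.Integer.Divisibility using (_∣_)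
open import Data.Integer.Divisibility.Signed as Signed using (divides; _∣?_) renaming (_∣_ to _∣ₛ_)
open import Data.Integer.Tactic.RingSolver using (solve-∀)
open import Data.Product using (Σ; ∃; _×_; _,_; proj₁; proj₂)
open import Data.Sum as Sum using (_⊎_; inj₁; inj₂; [_,_])
open import Data.Empty using (⊥-elim)
open import Function.Base using (_∘_; id)
open import Function.Bundles using (_⇔_; mk⇔)
open import Relation.Nullary using (¬_; Dec; yes; no)
open import Relation.Binary.PropositionalEquality using (_≡_; _≢_; refl; sym; trans; cong; cong₂; subst; module ≡-Reasoning)

∣-respʳ-≡ : ∀ {k x y} → x ≡ y → k ∣ₛ x → k ∣ₛ y
∣-respʳ-≡ {k} = subst (k ∣ₛ_)

∣-respˡ-≡ : ∀ {j k x} → j ≡ k → j ∣ₛ x → k ∣ₛ x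
∣-respˡ-≡ {x = x} = subst (_∣ₛ x)

∣-≡0 : ∀ {k z} → z ≡ + 0 → k ∣ₛ z
∣-≡0 z≡0 = ∣-respʳ-≡ (sym z≡0) (divides (+ 0) refl)

∣m-n∣n⇒∣m : ∀ {k m n} → k ∣ₛ m - n → k ∣ₛ n → k ∣ₛ m
∣m-n∣n⇒∣m k∣m-n k∣n = Signed.∣m+n∣n⇒∣m k∣m-n (Signed.∣m⇒∣-m k∣n)

∣m-n∣m⇒∣n : ∀ {k m n} → k ∣ₛ m - n → k ∣ₛ m → k ∣ₛ n
∣m-n∣m⇒∣n {n = n} k∣m-n k∣m =
  ∣-respʳ-≡ (ℤ.neg-involutive n) (Signed.∣m⇒∣-m (Signed.∣m+n∣m⇒∣n k∣m-n k∣m))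

*-pres-∣ : ∀ {a b c d} → a ∣ₛ b → c ∣ₛ d → a * c ∣ₛ b * d
*-pres-∣ {a} {d = d} a∣b c∣d = Signed.∣-trans (Signed.*-monoʳ-∣ a c∣d) (Signed.*-monoˡ-∣ d a∣b)

[x-y]*z≡0 : ∀ {x y} z → x ≡ y → (x - y) * z ≡ + 0
[x-y]*z≡0 {x} z refl = cong (_* z) (ℤ.+-inverseʳ x)

constant : ∀ {p} → ℤ → ℤₚ p
approx (constant c) _ = c
coh (constant {p} c) k = Signed.∣⇒∣ᵤ {+ (p ℕ.^ k)} (∣-≡0 (ℤ.+-inverseʳ c))

rotate : ∀ {e₁ e₂ e₃ d₁ d₂ d₃ n p} →
  HasQpPoint e₁ e₂ e₃ d₁ d₂ d₃ n p → HasQpPoint e₂ e₃ e₁ d₂ d₃ d₁ n p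
rotate (t , u₁ , u₂ , u₃ , primitivity , vanish) =
  t , u₂ , u₃ , u₁ ,
  (λ (p∣t , p∣u₂ , p∣u₃ , p∣u₁) → primitivity (p∣t , p∣u₁ , p∣u₂ , p∣u₃)) ,
  λ k → let (v₁ , v₂ , v₃) = vanish k in v₂ , v₃ , v₁

-- The forms F₁, F₂, F₃ with + n generalised to an integer N, so that
-- F₁ … n … = Q₁ … (+ n) … holds definitionally and N can be rewritten to n′ * p.
Q₁ Q₂ Q₃ : (e₁ e₂ e₃ d₁ d₂ d₃ N t u₁ u₂ u₃ : ℤ) → ℤ
Q₁ e₁ e₂ e₃ d₁ d₂ d₃ N t u₁ u₂ u₃ = e₁ * N * t * t + d₂ * u₂ * u₂ - d₃ * u₃ * u₃
Q₂ e₁ e₂ e₃ d₁ d₂ d₃ N t u₁ u₂ u₃ = e₂ * N * t * t + d₃ * u₃ * u₃ - d₁ * u₁ * u₁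
Q₃ e₁ e₂ e₃ d₁ d₂ d₃ N t u₁ u₂ u₃ = e₃ * N * t * t + d₁ * u₁ * u₁ - d₂ * u₂ * u₂

Condition₁ : (d₁ d₂ d₃ : ℤ) (p : ℕ) → Set
Condition₁ d₁ d₂ d₃ p =
  ¬ (+ p ∣ d₁ * d₂ * d₃) → LegendreOne p d₁ × LegendreOne p d₂ × LegendreOne p d₃

Condition₂ Condition₃ Condition₄ : (e₁ e₂ e₃ d₁ d₂ d₃ : ℤ) (n p : ℕ) → Set
Condition₂ e₁ e₂ e₃ d₁ d₂ d₃ n p = ¬ (+ p ∣ d₁) → + p ∣ d₂ → + p ∣ d₃ →
  LegendreOne p (- e₂ * e₃ * d₁) × LegendreOneFrac p (e₃ * + n) d₂ × LegendreOneFrac p (- e₂ * + n) d₃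
Condition₃ e₁ e₂ e₃ d₁ d₂ d₃ n p = + p ∣ d₁ → ¬ (+ p ∣ d₂) → + p ∣ d₃ →
  LegendreOneFrac p (- e₃ * + n) d₁ × LegendreOne p (- e₃ * e₁ * d₂) × LegendreOneFrac p (e₁ * + n) d₃
Condition₄ e₁ e₂ e₃ d₁ d₂ d₃ n p = + p ∣ d₁ → + p ∣ d₂ → ¬ (+ p ∣ d₃) →
  LegendreOneFrac p (e₂ * + n) d₁ × LegendreOneFrac p (- e₁ * + n) d₂ × LegendreOne p (- e₁ * e₂ * d₃)

LocalConditions : (e₁ e₂ e₃ d₁ d₂ d₃ : ℤ) (n p : ℕ) → Set
LocalConditions e₁ e₂ e₃ d₁ d₂ d₃ n p =
  Condition₁ d₁ d₂ d₃ p × Condition₂ e₁ e₂ e₃ d₁ d₂ d₃ n p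
  × Condition₃ e₁ e₂ e₃ d₁ d₂ d₃ n p × Condition₄ e₁ e₂ e₃ d₁ d₂ d₃ n p

module _ {p : ℕ} (p-prime : Prime p) where

  P : ℤ
  P = + p

  instance
    P-nonZero : ℤ.NonZero P
    P-nonZero = prime⇒nonZero p-prime

  p≢1 : p ≢ 1
  p≢1 = ℕ.nonTrivial⇒≢1 {{prime⇒nonTrivial p-prime}}

  P^_ : ℕ → ℤ
  P^ k = + (p ℕ.^ k)

  P^-suc : ∀ k → P^ suc k ≡ P * P^ k
  P^-suc k = ℤ.pos-* p (p ℕ.^ k)

  P^1 : P^ 1 ≡ P
  P^1 = cong +_ (ℕ.*-identityʳ p)

  P^2 : P^ 2 ≡ P * P
  P^2 = trans (P^-suc 1) (cong (P *_) P^1)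

  P^k∣P^suck : ∀ k → P^ k ∣ₛ P^ suc k
  P^k∣P^suck k = divides P (P^-suc k)

  P∣P^suck : ∀ k → P ∣ₛ P^ suc k
  P∣P^suck k = divides (P^ k) (trans (P^-suc k) (ℤ.*-comm P (P^ k)))

  p²∣⇒p∣ : ∀ {x} → P * P ∣ₛ x → P ∣ₛ x
  p²∣⇒p∣ = Signed.∣-trans (Signed.∣m⇒∣m*n P Signed.∣-refl)

  p∣ab⇒p∣a⊎p∣b : ∀ {a b} → P ∣ₛ a * b → P ∣ₛ a ⊎ P ∣ₛ b
  p∣ab⇒p∣a⊎p∣b {a} {b} p∣ab = Sum.map Signed.∣ᵤ⇒∣ Signed.∣ᵤ⇒∣
    (euclidsLemma ∣ a ∣ ∣ b ∣ p-prime (subst (p ∣ℕ_) (ℤ.abs-* a b) (Signed.∣⇒∣ᵤ p∣ab)))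

  p∤-* : ∀ {a b} → ¬ P ∣ₛ a → ¬ P ∣ₛ b → ¬ P ∣ₛ a * b
  p∤-* {a} {b} p∤a p∤b = [ p∤a , p∤b ] ∘ p∣ab⇒p∣a⊎p∣b {a} {b}

  p∤-factors : ∀ {a b c} → ¬ P ∣ₛ a * b * c → ¬ P ∣ₛ a × ¬ P ∣ₛ b × ¬ P ∣ₛ c
  p∤-factors {a} {b} {c} p∤abc =
    p∤abc ∘ Signed.∣m⇒∣m*n c ∘ Signed.∣m⇒∣m*n b ,
    p∤abc ∘ Signed.∣m⇒∣m*n c ∘ Signed.∣n⇒∣m*n a ,
    p∤abc ∘ Signed.∣n⇒∣m*n (a * b)

  p∤-neg : ∀ {a} → ¬ P ∣ₛ a → ¬ P ∣ₛ - a
  p∤-neg {a} p∤a = p∤a ∘ ∣-respʳ-≡ (ℤ.neg-involutive a) ∘ Signed.∣m⇒∣-m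

  p∣a²⇒p∣a : ∀ {a} → P ∣ₛ a * a → P ∣ₛ a
  p∣a²⇒p∣a {a} = [ id , id ] ∘ p∣ab⇒p∣a⊎p∣b {a} {a}

  p∣xu²⇒p∣u : ∀ {x u} → ¬ P ∣ₛ x → P ∣ₛ x * u * u → P ∣ₛ u
  p∣xu²⇒p∣u {x} {u} p∤x =
    [ [ ⊥-elim ∘ p∤x , id ] ∘ p∣ab⇒p∣a⊎p∣b {x} {u} , id ] ∘ p∣ab⇒p∣a⊎p∣b {x * u} {u}

  p∣u⇒p∣xu² : ∀ x {u} → P ∣ₛ u → P ∣ₛ x * u * u
  p∣u⇒p∣xu² x {u} p∣u = Signed.∣m⇒∣m*n u (Signed.∣n⇒∣m*n x p∣u)

  p∣u⇒p²∣xu² : ∀ x {u} → P ∣ₛ u → P * P ∣ₛ x * u * u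
  p∣u⇒p²∣xu² x {u} p∣u = ∣-respʳ-≡ (sym (ℤ.*-assoc x u u)) (Signed.∣n⇒∣m*n x (*-pres-∣ p∣u p∣u))

  p∤-root : ∀ {a x} → ¬ P ∣ₛ a → P ∣ₛ x * x - a → ¬ P ∣ₛ x
  p∤-root {x = x} p∤a p∣x²-a p∣x = p∤a (∣m-n∣m⇒∣n p∣x²-a (Signed.∣m⇒∣m*n x p∣x))

  prime∤⇒coprime : ∀ {m} → ¬ p ∣ℕ m → Coprime p m
  prime∤⇒coprime p∤m (d∣p , d∣m) with prime⇒irreducible p-prime d∣p
  ... | inj₁ d≡1 = d≡1
  ... | inj₂ refl = ⊥-elim (p∤m d∣m)

  toℤ : ∀ a b c d → 1 ℕ.+ a ℕ.* b ≡ c ℕ.* d → + 1 + + a * + b ≡ + c * + d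
  toℤ a b c d eq =
    trans (cong (_+_ (+ 1)) (sym (ℤ.pos-* a b))) (trans (cong +_ eq) (ℤ.pos-* c d))

  invertibleℕ : ∀ {m} → ¬ p ∣ℕ m → ∃ λ m⁻¹ → P ∣ₛ + m * m⁻¹ - + 1
  invertibleℕ {m} p∤m with coprime-Bézout (prime∤⇒coprime p∤m)
  ... | Bézout.+- x y 1+ym≡xp = - + y , divides (- + x) (begin
    + m * - + y - + 1    ≡⟨ identity (+ m) (+ y) ⟩
    - (+ 1 + + y * + m)  ≡⟨ cong -_ (toℤ y m x p 1+ym≡xp) ⟩
    - (+ x * P)          ≡⟨ ℤ.neg-distribˡ-* (+ x) P ⟩
    - + x * P            ∎)
    where
    open ≡-Reasoning
    identity : ∀ m y → m * - y - + 1 ≡ - (+ 1 + y * m)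
    identity = solve-∀
  ... | Bézout.-+ x y 1+xp≡ym = + y , divides (+ x) (begin
    + m * + y - + 1      ≡⟨ cong (_- + 1) (ℤ.*-comm (+ m) (+ y)) ⟩
    + y * + m - + 1      ≡⟨ cong (_- + 1) (sym (toℤ x p y m 1+xp≡ym)) ⟩
    + 1 + + x * P - + 1  ≡⟨ identity (+ x * P) ⟩
    + x * P              ∎)
    where
    open ≡-Reasoning
    identity : ∀ z → + 1 + z - + 1 ≡ z
    identity = solve-∀

  invertible : ∀ {c} → ¬ P ∣ₛ c → ∃ λ c⁻¹ → P ∣ₛ c * c⁻¹ - + 1
  invertible {c} p∤c with invertibleℕ (p∤c ∘ Signed.∣ᵤ⇒∣) | ℤ.+∣i∣≡i⊎+∣i∣≡-i c
  ... | y , p∣ | inj₁ ∣c∣≡c  = y , subst (λ z → P ∣ₛ z * y - + 1) ∣c∣≡c p∣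
  ... | y , p∣ | inj₂ ∣c∣≡-c = - y , ∣-respʳ-≡ (identity c y) (subst (λ z → P ∣ₛ z * y - + 1) ∣c∣≡-c p∣)
    where
    identity : ∀ c y → - c * y - + 1 ≡ c * - y - + 1
    identity = solve-∀

  mkLegendreOne : ∀ {a} x → ¬ P ∣ₛ a → P ∣ₛ x * x - a → LegendreOne p a
  mkLegendreOne x p∤a p∣x²-a = p∤a ∘ Signed.∣ᵤ⇒∣ , x , Signed.∣⇒∣ᵤ p∣x²-a

  squareMod⇒legendreOne : ∀ {a c} x → ¬ P ∣ₛ a → ¬ P ∣ₛ c → P ∣ₛ x * x - a * (c * c) → LegendreOne p a
  squareMod⇒legendreOne {a} {c} x p∤a p∤c p∣ with invertible p∤c
  ... | c⁻¹ , p∣cc⁻¹-1 = mkLegendreOne (x * c⁻¹) p∤a (∣-respʳ-≡ (identity x a c c⁻¹)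
    (Signed.∣m∣n⇒∣m+n (Signed.∣n⇒∣m*n (c⁻¹ * c⁻¹) p∣)
                      (Signed.∣n⇒∣m*n a (Signed.∣m⇒∣m*n (c * c⁻¹ + + 1) p∣cc⁻¹-1))))
    where
    identity : ∀ x a c c⁻¹ → c⁻¹ * c⁻¹ * (x * x - a * (c * c)) + a * ((c * c⁻¹ - + 1) * (c * c⁻¹ + + 1))
                             ≡ x * c⁻¹ * (x * c⁻¹) - a
    identity = solve-∀

  legendreOne-cancel-square : ∀ {a c} → ¬ P ∣ₛ c → LegendreOne p (a * (c * c)) → LegendreOne p a
  legendreOne-cancel-square {c = c} p∤c (p∤acc , x , p∣) =
    squareMod⇒legendreOne x (p∤acc ∘ Signed.∣⇒∣ᵤ ∘ Signed.∣m⇒∣m*n (c * c)) p∤c (Signed.∣ᵤ⇒∣ p∣)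

  legendreOne-square : ∀ {b} → ¬ P ∣ₛ b → LegendreOne p (b * b)
  legendreOne-square {b} p∤b = mkLegendreOne b (p∤-* p∤b p∤b) (∣-≡0 (ℤ.+-inverseʳ (b * b)))

  legendreOne-* : ∀ {a b} → LegendreOne p a → LegendreOne p b → LegendreOne p (a * b)
  legendreOne-* {a} {b} (p∤a , x , p∣x²-a) (p∤b , y , p∣y²-b) =
    mkLegendreOne (x * y) (p∤-* {a} {b} (p∤a ∘ Signed.∣⇒∣ᵤ) (p∤b ∘ Signed.∣⇒∣ᵤ)) (∣-respʳ-≡ (identity x y a b)
      (Signed.∣m∣n⇒∣m+n (Signed.∣n⇒∣m*n (y * y) (Signed.∣ᵤ⇒∣ p∣x²-a))
                        (Signed.∣n⇒∣m*n a (Signed.∣ᵤ⇒∣ p∣y²-b))))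
    where
    identity : ∀ x y a b → y * y * (x * x - a) + a * (y * y - b) ≡ x * y * (x * y) - a * b
    identity = solve-∀

  legendreOneFrac-p¹ : ∀ {A B a b} → A ≡ a * P → B ≡ b * P → ¬ P ∣ₛ a → ¬ P ∣ₛ b →
                       LegendreOne p (a * b) → LegendreOneFrac p A B
  legendreOneFrac-p¹ {a = a} {b} A≡aP B≡bP p∤a p∤b L =
    1 , a , b , trans A≡aP (times-P¹ a) , trans B≡bP (times-P¹ b) ,
    p∤a ∘ Signed.∣ᵤ⇒∣ , p∤b ∘ Signed.∣ᵤ⇒∣ , L
    where
    times-P¹ : ∀ x → x * P ≡ P^ 1 * x
    times-P¹ x = trans (ℤ.*-comm x P) (cong (_* x) (sym P^1))

  SquareRoot : ℤ → Set
  SquareRoot a = Σ (ℤₚ p) λ y → ∀ k → P^ k ∣ₛ approx y k * approx y k - a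

  constant-root : ∀ c → SquareRoot (c * c)
  constant-root c = constant c , λ _ → ∣-≡0 (ℤ.+-inverseʳ (c * c))

  ∣-form-at-roots : ∀ {k} E d d′ U V c c′ → k ∣ₛ U * U - c → k ∣ₛ V * V - c′ →
                    E + d * c - d′ * c′ ≡ + 0 → k ∣ₛ E + d * U * U - d′ * V * V
  ∣-form-at-roots E d d′ U V c c′ k∣U²-c k∣V²-c′ vanish = ∣-respʳ-≡ (identity E d d′ U V c c′)
    (Signed.∣m∣n⇒∣m+n (Signed.∣m∣n⇒∣m-n (Signed.∣n⇒∣m*n d k∣U²-c) (Signed.∣n⇒∣m*n d′ k∣V²-c′)) (∣-≡0 vanish))
    where
    identity : ∀ E d d′ U V c c′ → d * (U * U - c) - d′ * (V * V - c′) + (E + d * c - d′ * c′)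
                                   ≡ E + d * U * U - d′ * V * V
    identity = solve-∀

  point-from-roots : ∀ {e₁ e₂ e₃ d₁ d₂ d₃ n} t c₁ c₂ c₃ (u₁ : SquareRoot c₁) → SquareRoot c₂ → SquareRoot c₃ →
    ¬ P ∣ₛ t ⊎ ¬ P ∣ₛ approx (proj₁ u₁) 1 →
    e₁ * + n * t * t + d₂ * c₂ - d₃ * c₃ ≡ + 0 →
    e₂ * + n * t * t + d₃ * c₃ - d₁ * c₁ ≡ + 0 →
    e₃ * + n * t * t + d₁ * c₁ - d₂ * c₂ ≡ + 0 →
    HasQpPoint e₁ e₂ e₃ d₁ d₂ d₃ n p
  point-from-roots {e₁} {e₂} {e₃} {d₁} {d₂} {d₃} {n} t c₁ c₂ c₃ (u₁ , u₁²≡c₁) (u₂ , u₂²≡c₂) (u₃ , u₃²≡c₃) unit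
                   vanish₁ vanish₂ vanish₃ =
    constant t , u₁ , u₂ , u₃ ,
    (λ (p∣t , p∣u₁ , _) → [ (λ p∤t → p∤t (Signed.∣ᵤ⇒∣ p∣t)) , (λ p∤u₁ → p∤u₁ (Signed.∣ᵤ⇒∣ p∣u₁)) ] unit) ,
    λ k → Signed.∣⇒∣ᵤ (∣-form-at-roots (e₁ * + n * t * t) d₂ d₃ (approx u₂ k) (approx u₃ k) c₂ c₃
                                         (u₂²≡c₂ k) (u₃²≡c₃ k) vanish₁) ,
          Signed.∣⇒∣ᵤ (∣-form-at-roots (e₂ * + n * t * t) d₃ d₁ (approx u₃ k) (approx u₁ k) c₃ c₁
                                         (u₃²≡c₃ k) (u₁²≡c₁ k) vanish₂) ,
          Signed.∣⇒∣ᵤ (∣-form-at-roots (e₃ * + n * t * t) d₁ d₂ (approx u₁ k) (approx u₂ k) c₁ c₂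
                                         (u₁²≡c₁ k) (u₂²≡c₂ k) vanish₃)

  squareFree⇒p²∤ : ∀ {d} → SquareFree d → ¬ P * P ∣ₛ d
  squareFree⇒p²∤ {d} sf p²∣d = p≢1 (sf p (subst (_∣ℕ ∣ d ∣) (ℤ.abs-* P P) (Signed.∣⇒∣ᵤ p²∣d)))

  squareFree-split : ∀ {d} → SquareFree d → P ∣ₛ d → ∃ λ b → d ≡ b * P × ¬ P ∣ₛ b
  squareFree-split sf (divides b refl) = b , refl , squareFree⇒p²∤ sf ∘ Signed.*-monoˡ-∣ P

  p∣square : ∀ {m} → P ∣ₛ m * m → ∃ λ s → m * m ≡ s * s * (P * P)
  p∣square {m} p∣m² with p∣a²⇒p∣a {m} p∣m²
  ... | divides s refl = s , identity s P
    where
    identity : ∀ s P → s * P * (s * P) ≡ s * s * (P * P)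
    identity = solve-∀

  p²-times-square : ∀ {x m} → x * (P * P) ≡ m * m → ∃ λ r → x ≡ r * r
  p²-times-square {x} {m} x·p²≡m²
    with p∣square {m} (∣-respʳ-≡ x·p²≡m² (Signed.∣n⇒∣m*n x (Signed.∣n⇒∣m*n P Signed.∣-refl)))
  ... | s , m²≡s²p² = s , ℤ.*-cancelʳ-≡ x (s * s) (P * P) {{ℤ.i*j≢0 P P}} (trans x·p²≡m² m²≡s²p²)

  p-times-unit≢square : ∀ {a m} → ¬ P ∣ₛ a → a * P ≢ m * m
  p-times-unit≢square {a} {m} p∤a a·p≡m² with p∣square {m} (∣-respʳ-≡ a·p≡m² (Signed.∣n⇒∣m*n a Signed.∣-refl))
  ... | s , m²≡s²p² =
    p∤a (divides (s * s) (ℤ.*-cancelʳ-≡ a (s * s * P) P (trans a·p≡m² (trans m²≡s²p² (identity s P)))))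
    where
    identity : ∀ s P → s * s * (P * P) ≡ s * s * P * P
    identity = solve-∀

  ¬square-p∣one : ∀ {d₁ d₂ d₃} → SquareFree d₁ → P ∣ₛ d₁ → ¬ P ∣ₛ d₂ → ¬ P ∣ₛ d₃ → ¬ IsSquare (d₁ * d₂ * d₃)
  ¬square-p∣one {d₂ = d₂} {d₃} sf₁ p∣d₁ p∤d₂ p∤d₃ (m , d₁d₂d₃≡m²) with squareFree-split sf₁ p∣d₁
  ... | b₁ , refl , p∤b₁ =
    p-times-unit≢square {m = m} (p∤-* (p∤-* p∤b₁ p∤d₂) p∤d₃) (trans (identity b₁ d₂ d₃ P) d₁d₂d₃≡m²)
    where
    identity : ∀ b₁ d₂ d₃ P → b₁ * d₂ * d₃ * P ≡ b₁ * P * d₂ * d₃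
    identity = solve-∀

  ¬square-p∣all : ∀ {d₁ d₂ d₃} → SquareFree d₁ → SquareFree d₂ → SquareFree d₃ →
                  P ∣ₛ d₁ → P ∣ₛ d₂ → P ∣ₛ d₃ → ¬ IsSquare (d₁ * d₂ * d₃)
  ¬square-p∣all sf₁ sf₂ sf₃ p∣d₁ p∣d₂ p∣d₃ (m , d₁d₂d₃≡m²)
    with squareFree-split sf₁ p∣d₁ | squareFree-split sf₂ p∣d₂ | squareFree-split sf₃ p∣d₃
  ... | b₁ , refl , p∤b₁ | b₂ , refl , p∤b₂ | b₃ , refl , p∤b₃ =
    let (r , b₁b₂b₃p≡r²) = p²-times-square {b₁ * b₂ * b₃ * P} {m} (trans (identity b₁ b₂ b₃ P) d₁d₂d₃≡m²)
    in p-times-unit≢square {m = r} (p∤-* (p∤-* p∤b₁ p∤b₂) p∤b₃) b₁b₂b₃p≡r²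
    where
    identity : ∀ b₁ b₂ b₃ P → b₁ * b₂ * b₃ * P * (P * P) ≡ b₁ * P * (b₂ * P) * (b₃ * P)
    identity = solve-∀

  record PrimitiveSolutionModP² (e₁ e₂ e₃ d₁ d₂ d₃ N : ℤ) : Set where
    field
      t u₁ u₂ u₃ : ℤ
      primitivity : ¬ (P ∣ₛ t × P ∣ₛ u₁ × P ∣ₛ u₂ × P ∣ₛ u₃)
      vanish₁ : P * P ∣ₛ Q₁ e₁ e₂ e₃ d₁ d₂ d₃ N t u₁ u₂ u₃
      vanish₂ : P * P ∣ₛ Q₂ e₁ e₂ e₃ d₁ d₂ d₃ N t u₁ u₂ u₃
      vanish₃ : P * P ∣ₛ Q₃ e₁ e₂ e₃ d₁ d₂ d₃ N t u₁ u₂ u₃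

  p∣approx₂⇒p∣approx₁ : (y : ℤₚ p) → P ∣ₛ approx y 2 → + p ∣ approx y 1
  p∣approx₂⇒p∣approx₁ y p∣y₂ = Signed.∣⇒∣ᵤ (∣m-n∣m⇒∣n (∣-respˡ-≡ P^1 (Signed.∣ᵤ⇒∣ (coh y 1))) p∣y₂)

  solution-mod-p² : ∀ {e₁ e₂ e₃ d₁ d₂ d₃ n} →
    HasQpPoint e₁ e₂ e₃ d₁ d₂ d₃ n p → PrimitiveSolutionModP² e₁ e₂ e₃ d₁ d₂ d₃ (+ n)
  solution-mod-p² (t , u₁ , u₂ , u₃ , primitivity , vanish) = record
    { t = approx t 2 ; u₁ = approx u₁ 2 ; u₂ = approx u₂ 2 ; u₃ = approx u₃ 2
    ; primitivity = λ (p∣t , p∣u₁ , p∣u₂ , p∣u₃) →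
        primitivity (p∣approx₂⇒p∣approx₁ t p∣t , p∣approx₂⇒p∣approx₁ u₁ p∣u₁ ,
                     p∣approx₂⇒p∣approx₁ u₂ p∣u₂ , p∣approx₂⇒p∣approx₁ u₃ p∣u₃)
    ; vanish₁ = ∣-respˡ-≡ P^2 (Signed.∣ᵤ⇒∣ (proj₁ (vanish 2)))
    ; vanish₂ = ∣-respˡ-≡ P^2 (Signed.∣ᵤ⇒∣ (proj₁ (proj₂ (vanish 2))))
    ; vanish₃ = ∣-respˡ-≡ P^2 (Signed.∣ᵤ⇒∣ (proj₂ (proj₂ (vanish 2))))
    }

  form-mod-p : ∀ e n′ t A B → P * P ∣ₛ e * (n′ * P) * t * t + A - B → P ∣ₛ A - B
  form-mod-p e n′ t A B p²∣ = ∣-respʳ-≡ (identity e n′ t A B P)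
    (Signed.∣m∣n⇒∣m-n (p²∣⇒p∣ p²∣) (divides (e * n′ * t * t) (identity′ e n′ t P)))
    where
    identity : ∀ e n′ t A B P → e * (n′ * P) * t * t + A - B - e * (n′ * P) * t * t ≡ A - B
    identity = solve-∀
    identity′ : ∀ e n′ t P → e * (n′ * P) * t * t ≡ e * n′ * t * t * P
    identity′ = solve-∀

  -- With Dᵢ = dᵢuᵢ²: d₁D₁² ≡ d₁D₂D₃ = (m u₂ u₃)² modulo p.
  d₁-square-mod-p : ∀ d₁ d₂ d₃ m u₁ u₂ u₃ → d₁ * d₂ * d₃ ≡ m * m →
    P ∣ₛ d₃ * u₃ * u₃ - d₁ * u₁ * u₁ → P ∣ₛ d₁ * u₁ * u₁ - d₂ * u₂ * u₂ →
    P ∣ₛ m * u₂ * u₃ * (m * u₂ * u₃) - d₁ * (d₁ * u₁ * u₁ * (d₁ * u₁ * u₁))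
  d₁-square-mod-p d₁ d₂ d₃ m u₁ u₂ u₃ d₁d₂d₃≡m² p∣D₃-D₁ p∣D₁-D₂ = ∣-respʳ-≡ (sym identity)
    (Signed.∣n⇒∣m*n d₁ (Signed.∣m∣n⇒∣m-n (Signed.∣n⇒∣m*n D₂ p∣D₃-D₁) (Signed.∣n⇒∣m*n D₁ p∣D₁-D₂)))
    where
    open ≡-Reasoning
    D₁ D₂ D₃ : ℤ
    D₁ = d₁ * u₁ * u₁
    D₂ = d₂ * u₂ * u₂
    D₃ = d₃ * u₃ * u₃
    step₁ : ∀ m u₂ u₃ X → m * u₂ * u₃ * (m * u₂ * u₃) - X ≡ m * m * (u₂ * u₂ * (u₃ * u₃)) - X
    step₁ = solve-∀
    step₂ : ∀ d₁ d₂ d₃ u₁ u₂ u₃ →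
      d₁ * d₂ * d₃ * (u₂ * u₂ * (u₃ * u₃)) - d₁ * (d₁ * u₁ * u₁ * (d₁ * u₁ * u₁))
      ≡ d₁ * (d₂ * u₂ * u₂ * (d₃ * u₃ * u₃ - d₁ * u₁ * u₁) - d₁ * u₁ * u₁ * (d₁ * u₁ * u₁ - d₂ * u₂ * u₂))
    step₂ = solve-∀
    identity : m * u₂ * u₃ * (m * u₂ * u₃) - d₁ * (D₁ * D₁) ≡ d₁ * (D₂ * (D₃ - D₁) - D₁ * (D₁ - D₂))
    identity = begin
      m * u₂ * u₃ * (m * u₂ * u₃) - d₁ * (D₁ * D₁)          ≡⟨ step₁ m u₂ u₃ (d₁ * (D₁ * D₁)) ⟩
      m * m * (u₂ * u₂ * (u₃ * u₃)) - d₁ * (D₁ * D₁)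
        ≡⟨ cong (λ z → z * (u₂ * u₂ * (u₃ * u₃)) - d₁ * (D₁ * D₁)) (sym d₁d₂d₃≡m²) ⟩
      d₁ * d₂ * d₃ * (u₂ * u₂ * (u₃ * u₃)) - d₁ * (D₁ * D₁) ≡⟨ step₂ d₁ d₂ d₃ u₁ u₂ u₃ ⟩
      d₁ * (D₂ * (D₃ - D₁) - D₁ * (D₁ - D₂))                ∎

  legendre-case₁ : ∀ {e₁ e₂ e₃ d₁ d₂ d₃ n′} → ¬ P ∣ₛ e₁ → ¬ P ∣ₛ n′ →
    ¬ P ∣ₛ d₁ → ¬ P ∣ₛ d₂ → ¬ P ∣ₛ d₃ → IsSquare (d₁ * d₂ * d₃) →
    PrimitiveSolutionModP² e₁ e₂ e₃ d₁ d₂ d₃ (n′ * P) → LegendreOne p d₁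
  legendre-case₁ {e₁} {e₂} {e₃} {d₁} {d₂} {d₃} {n′} p∤e₁ p∤n′ p∤d₁ p∤d₂ p∤d₃ (m , d₁d₂d₃≡m²) sol =
    squareMod⇒legendreOne (m * u₂ * u₃) p∤d₁ (p∤-* (p∤-* p∤d₁ p∤u₁) p∤u₁)
      (d₁-square-mod-p d₁ d₂ d₃ m u₁ u₂ u₃ d₁d₂d₃≡m² p∣d₃u₃²-d₁u₁² p∣d₁u₁²-d₂u₂²)
    where
    open PrimitiveSolutionModP² sol

    p∣d₂u₂²-d₃u₃² : P ∣ₛ d₂ * u₂ * u₂ - d₃ * u₃ * u₃
    p∣d₂u₂²-d₃u₃² = form-mod-p e₁ n′ t (d₂ * u₂ * u₂) (d₃ * u₃ * u₃) vanish₁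
    p∣d₃u₃²-d₁u₁² : P ∣ₛ d₃ * u₃ * u₃ - d₁ * u₁ * u₁
    p∣d₃u₃²-d₁u₁² = form-mod-p e₂ n′ t (d₃ * u₃ * u₃) (d₁ * u₁ * u₁) vanish₂
    p∣d₁u₁²-d₂u₂² : P ∣ₛ d₁ * u₁ * u₁ - d₂ * u₂ * u₂
    p∣d₁u₁²-d₂u₂² = form-mod-p e₃ n′ t (d₁ * u₁ * u₁) (d₂ * u₂ * u₂) vanish₃

    p∤u₁ : ¬ P ∣ₛ u₁
    p∤u₁ p∣u₁ = primitivity (p∣t , p∣u₁ , p∣u₂ , p∣u₃)
      where
      p∣u₃ : P ∣ₛ u₃
      p∣u₃ = p∣xu²⇒p∣u p∤d₃ (∣m-n∣n⇒∣m p∣d₃u₃²-d₁u₁² (p∣u⇒p∣xu² d₁ p∣u₁))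
      p∣u₂ : P ∣ₛ u₂
      p∣u₂ = p∣xu²⇒p∣u p∤d₂ (∣m-n∣n⇒∣m p∣d₂u₂²-d₃u₃² (p∣u⇒p∣xu² d₃ p∣u₃))
      identity : ∀ e n′ t d₂ u₂ d₃ u₃ P →
        e * (n′ * P) * t * t + d₂ * u₂ * u₂ - d₃ * u₃ * u₃ - d₂ * u₂ * u₂ + d₃ * u₃ * u₃ ≡ e * n′ * t * t * P
      identity = solve-∀
      p∣t : P ∣ₛ t
      p∣t = p∣xu²⇒p∣u (p∤-* p∤e₁ p∤n′) (Signed.*-cancelʳ-∣ P (∣-respʳ-≡ (identity e₁ n′ t d₂ u₂ d₃ u₃ P)
              (Signed.∣m∣n⇒∣m+n (Signed.∣m∣n⇒∣m-n vanish₁ (p∣u⇒p²∣xu² d₂ p∣u₂)) (p∣u⇒p²∣xu² d₃ p∣u₃))))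

  reduce-case₂ : ∀ {e₁ e₂ e₃ d₁ b₂ b₃ n′} → ¬ P ∣ₛ d₁ → ¬ P ∣ₛ b₂ → ¬ P ∣ₛ b₃ →
    (sol : PrimitiveSolutionModP² e₁ e₂ e₃ d₁ (b₂ * P) (b₃ * P) (n′ * P)) →
    let open PrimitiveSolutionModP² sol in
    ¬ P ∣ₛ t × P ∣ₛ e₂ * n′ * t * t + b₃ * u₃ * u₃ × P ∣ₛ e₃ * n′ * t * t - b₂ * u₂ * u₂
  reduce-case₂ {e₁} {e₂} {e₃} {d₁} {b₂} {b₃} {n′} p∤d₁ p∤b₂ p∤b₃ sol =
    p∤t , p∣e₂n′t²+b₃u₃² , p∣e₃n′t²-b₂u₂²
    where
    open PrimitiveSolutionModP² sol

    p∣u₁ : P ∣ₛ u₁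
    p∣u₁ = p∣xu²⇒p∣u p∤d₁ (∣m-n∣m⇒∣n (form-mod-p e₂ n′ t (b₃ * P * u₃ * u₃) (d₁ * u₁ * u₁) vanish₂)
      (Signed.∣m⇒∣m*n u₃ (Signed.∣m⇒∣m*n u₃ (Signed.∣n⇒∣m*n b₃ (Signed.∣-refl {P})))))

    identity₂ : ∀ e n′ t b₃ u₃ d₁ u₁ P → e * (n′ * P) * t * t + b₃ * P * u₃ * u₃ - d₁ * u₁ * u₁ + d₁ * u₁ * u₁
                                         ≡ (e * n′ * t * t + b₃ * u₃ * u₃) * P
    identity₂ = solve-∀
    p∣e₂n′t²+b₃u₃² : P ∣ₛ e₂ * n′ * t * t + b₃ * u₃ * u₃
    p∣e₂n′t²+b₃u₃² = Signed.*-cancelʳ-∣ P (∣-respʳ-≡ (identity₂ e₂ n′ t b₃ u₃ d₁ u₁ P)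
      (Signed.∣m∣n⇒∣m+n vanish₂ (p∣u⇒p²∣xu² d₁ p∣u₁)))

    identity₃ : ∀ e n′ t d₁ u₁ b₂ u₂ P → e * (n′ * P) * t * t + d₁ * u₁ * u₁ - b₂ * P * u₂ * u₂ - d₁ * u₁ * u₁
                                         ≡ (e * n′ * t * t - b₂ * u₂ * u₂) * P
    identity₃ = solve-∀
    p∣e₃n′t²-b₂u₂² : P ∣ₛ e₃ * n′ * t * t - b₂ * u₂ * u₂
    p∣e₃n′t²-b₂u₂² = Signed.*-cancelʳ-∣ P (∣-respʳ-≡ (identity₃ e₃ n′ t d₁ u₁ b₂ u₂ P)
      (Signed.∣m∣n⇒∣m-n vanish₃ (p∣u⇒p²∣xu² d₁ p∣u₁)))

    p∤t : ¬ P ∣ₛ t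
    p∤t p∣t = primitivity (p∣t , p∣u₁ , p∣u₂ , p∣u₃)
      where
      p∣u₂ : P ∣ₛ u₂
      p∣u₂ = p∣xu²⇒p∣u p∤b₂ (∣m-n∣m⇒∣n p∣e₃n′t²-b₂u₂² (p∣u⇒p∣xu² (e₃ * n′) p∣t))
      p∣u₃ : P ∣ₛ u₃
      p∣u₃ = p∣xu²⇒p∣u p∤b₃ (Signed.∣m+n∣m⇒∣n p∣e₂n′t²+b₃u₃² (p∣u⇒p∣xu² (e₂ * n′) p∣t))

  legendreOne-neg-e₂e₃d₁ : ∀ {e₂ e₃ d₁ b₂ b₃ n′ r} → ¬ P ∣ₛ n′ → ¬ P ∣ₛ r → d₁ * b₂ * b₃ ≡ r * r →
    ¬ P ∣ₛ d₁ → LegendreOne p (e₃ * n′ * b₂) → LegendreOne p (- e₂ * n′ * b₃) → LegendreOne p (- e₂ * e₃ * d₁)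
  legendreOne-neg-e₂e₃d₁ {e₂} {e₃} {d₁} {b₂} {b₃} {n′} {r} p∤n′ p∤r d₁b₂b₃≡r² p∤d₁ L₂ L₃ =
    legendreOne-cancel-square (p∤-* p∤n′ p∤r) (subst (LegendreOne p) identity
      (legendreOne-* (legendreOne-* L₂ L₃) (legendreOne-square p∤d₁)))
    where
    open ≡-Reasoning
    step₁ : ∀ e₂ e₃ d₁ b₂ b₃ n′ →
      e₃ * n′ * b₂ * (- e₂ * n′ * b₃) * (d₁ * d₁) ≡ - e₂ * e₃ * d₁ * (n′ * n′ * (d₁ * b₂ * b₃))
    step₁ = solve-∀
    step₂ : ∀ a n′ r → a * (n′ * n′ * (r * r)) ≡ a * (n′ * r * (n′ * r))
    step₂ = solve-∀
    identity : e₃ * n′ * b₂ * (- e₂ * n′ * b₃) * (d₁ * d₁) ≡ - e₂ * e₃ * d₁ * (n′ * r * (n′ * r))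
    identity = begin
      e₃ * n′ * b₂ * (- e₂ * n′ * b₃) * (d₁ * d₁)        ≡⟨ step₁ e₂ e₃ d₁ b₂ b₃ n′ ⟩
      - e₂ * e₃ * d₁ * (n′ * n′ * (d₁ * b₂ * b₃))
        ≡⟨ cong (λ z → - e₂ * e₃ * d₁ * (n′ * n′ * z)) d₁b₂b₃≡r² ⟩
      - e₂ * e₃ * d₁ * (n′ * n′ * (r * r))               ≡⟨ step₂ (- e₂ * e₃ * d₁) n′ r ⟩
      - e₂ * e₃ * d₁ * (n′ * r * (n′ * r))               ∎

  legendre-case₂ : ∀ {e₁ e₂ e₃ d₁ b₂ b₃ n′} → ¬ P ∣ₛ e₂ → ¬ P ∣ₛ e₃ → ¬ P ∣ₛ n′ →
    ¬ P ∣ₛ d₁ → ¬ P ∣ₛ b₂ → ¬ P ∣ₛ b₃ → IsSquare (d₁ * b₂ * b₃) →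
    PrimitiveSolutionModP² e₁ e₂ e₃ d₁ (b₂ * P) (b₃ * P) (n′ * P) →
    LegendreOne p (- e₂ * e₃ * d₁) × LegendreOne p (e₃ * n′ * b₂) × LegendreOne p (- e₂ * n′ * b₃)
  legendre-case₂ {e₁} {e₂} {e₃} {d₁} {b₂} {b₃} {n′} p∤e₂ p∤e₃ p∤n′ p∤d₁ p∤b₂ p∤b₃ (r , d₁b₂b₃≡r²) sol =
    legendreOne-neg-e₂e₃d₁ {e₂} {e₃} {d₁} {b₂} {b₃} p∤n′ p∤r d₁b₂b₃≡r² p∤d₁ L₂ L₃ , L₂ , L₃
    where
    open PrimitiveSolutionModP² sol

    p∤t : ¬ P ∣ₛ t
    p∤t = proj₁ (reduce-case₂ {n′ = n′} p∤d₁ p∤b₂ p∤b₃ sol)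
    p∣e₂n′t²+b₃u₃² : P ∣ₛ e₂ * n′ * t * t + b₃ * u₃ * u₃
    p∣e₂n′t²+b₃u₃² = proj₁ (proj₂ (reduce-case₂ {n′ = n′} p∤d₁ p∤b₂ p∤b₃ sol))
    p∣e₃n′t²-b₂u₂² : P ∣ₛ e₃ * n′ * t * t - b₂ * u₂ * u₂
    p∣e₃n′t²-b₂u₂² = proj₂ (proj₂ (reduce-case₂ {n′ = n′} p∤d₁ p∤b₂ p∤b₃ sol))

    L₂ : LegendreOne p (e₃ * n′ * b₂)
    L₂ = squareMod⇒legendreOne (b₂ * u₂) (p∤-* (p∤-* p∤e₃ p∤n′) p∤b₂) p∤t
      (∣-respʳ-≡ (identity e₃ n′ t b₂ u₂) (Signed.∣m⇒∣-m (Signed.∣n⇒∣m*n b₂ p∣e₃n′t²-b₂u₂²)))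
      where
      identity : ∀ e n′ t b u → - (b * (e * n′ * t * t - b * u * u)) ≡ b * u * (b * u) - e * n′ * b * (t * t)
      identity = solve-∀

    L₃ : LegendreOne p (- e₂ * n′ * b₃)
    L₃ = squareMod⇒legendreOne (b₃ * u₃) (p∤-* (p∤-* (p∤-neg p∤e₂) p∤n′) p∤b₃) p∤t
      (∣-respʳ-≡ (identity e₂ n′ t b₃ u₃) (Signed.∣n⇒∣m*n b₃ p∣e₂n′t²+b₃u₃²))
      where
      identity : ∀ e n′ t b u → b * (e * n′ * t * t + b * u * u) ≡ b * u * (b * u) - - e * n′ * b * (t * t)
      identity = solve-∀

    p∤r : ¬ P ∣ₛ r
    p∤r p∣r = p∤-* (p∤-* p∤d₁ p∤b₂) p∤b₃ (∣-respʳ-≡ (sym d₁b₂b₃≡r²) (Signed.∣m⇒∣m*n r p∣r))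

  record Hypotheses (e₁ e₂ e₃ d₁ d₂ d₃ : ℤ) (n : ℕ) : Set where
    field
      p∤e₁ : ¬ P ∣ₛ e₁
      p∤e₂ : ¬ P ∣ₛ e₂
      p∤e₃ : ¬ P ∣ₛ e₃
      e₁+e₂+e₃≡0 : e₁ + e₂ + e₃ ≡ + 0
      squareFree₁ : SquareFree d₁
      squareFree₂ : SquareFree d₂
      squareFree₃ : SquareFree d₃
      d₁d₂d₃-square : IsSquare (d₁ * d₂ * d₃)
      n′ : ℤ
      n≡n′p : + n ≡ n′ * P
      p∤n′ : ¬ P ∣ₛ n′

  hypotheses : ∀ {e₁ e₂ e₃ d₁ d₂ d₃ n} → e₁ + e₂ + e₃ ≡ + 0 →
    SquareFree d₁ → SquareFree d₂ → SquareFree d₃ → IsSquare (d₁ * d₂ * d₃) →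
    SquareFree (+ n) → Coprime n ∣ e₁ * e₂ * e₃ ∣ → p ∣ℕ n → Hypotheses e₁ e₂ e₃ d₁ d₂ d₃ n
  hypotheses {e₁} {e₂} {e₃} {n = n} e-sum sf₁ sf₂ sf₃ square sf-n coprime p∣n = record
    { p∤e₁ = proj₁ p∤eᵢ ; p∤e₂ = proj₁ (proj₂ p∤eᵢ) ; p∤e₃ = proj₂ (proj₂ p∤eᵢ)
    ; e₁+e₂+e₃≡0 = e-sum
    ; squareFree₁ = sf₁ ; squareFree₂ = sf₂ ; squareFree₃ = sf₃
    ; d₁d₂d₃-square = square
    ; n′ = proj₁ n-split ; n≡n′p = proj₁ (proj₂ n-split) ; p∤n′ = proj₂ (proj₂ n-split)
    }
    where
    p∤eᵢ : ¬ P ∣ₛ e₁ × ¬ P ∣ₛ e₂ × ¬ P ∣ₛ e₃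
    p∤eᵢ = p∤-factors {e₁} {e₂} {e₃} (λ p∣e₁e₂e₃ → p≢1 (coprime (p∣n , Signed.∣⇒∣ᵤ p∣e₁e₂e₃)))
    n-split : ∃ λ n′ → + n ≡ n′ * P × ¬ P ∣ₛ n′
    n-split = squareFree-split {+ n} sf-n (Signed.∣ᵤ⇒∣ p∣n)

  rotate-hypotheses : ∀ {e₁ e₂ e₃ d₁ d₂ d₃ n} →
    Hypotheses e₁ e₂ e₃ d₁ d₂ d₃ n → Hypotheses e₂ e₃ e₁ d₂ d₃ d₁ n
  rotate-hypotheses {e₁} {e₂} {e₃} {d₁} {d₂} {d₃} H = record
    { p∤e₁ = p∤e₂ ; p∤e₂ = p∤e₃ ; p∤e₃ = p∤e₁
    ; e₁+e₂+e₃≡0 = trans (+-rotate e₁ e₂ e₃) e₁+e₂+e₃≡0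
    ; squareFree₁ = squareFree₂ ; squareFree₂ = squareFree₃ ; squareFree₃ = squareFree₁
    ; d₁d₂d₃-square = proj₁ d₁d₂d₃-square , trans (*-rotate d₁ d₂ d₃) (proj₂ d₁d₂d₃-square)
    ; n′ = n′ ; n≡n′p = n≡n′p ; p∤n′ = p∤n′
    }
    where
    open Hypotheses H
    +-rotate : ∀ a b c → b + c + a ≡ a + b + c
    +-rotate = solve-∀
    *-rotate : ∀ a b c → b * c * a ≡ a * b * c
    *-rotate = solve-∀

  necessary₁ : ∀ {e₁ e₂ e₃ d₁ d₂ d₃ n} → Hypotheses e₁ e₂ e₃ d₁ d₂ d₃ n → HasQpPoint e₁ e₂ e₃ d₁ d₂ d₃ n p →
               ¬ P ∣ₛ d₁ → ¬ P ∣ₛ d₂ → ¬ P ∣ₛ d₃ → LegendreOne p d₁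
  necessary₁ {e₁} {e₂} {e₃} {d₁} {d₂} {d₃} H x p∤d₁ p∤d₂ p∤d₃ =
    legendre-case₁ p∤e₁ p∤n′ p∤d₁ p∤d₂ p∤d₃ d₁d₂d₃-square
      (subst (PrimitiveSolutionModP² e₁ e₂ e₃ d₁ d₂ d₃) n≡n′p (solution-mod-p² x))
    where open Hypotheses H

  necessary₂ : ∀ {e₁ e₂ e₃ d₁ d₂ d₃ n} → Hypotheses e₁ e₂ e₃ d₁ d₂ d₃ n → HasQpPoint e₁ e₂ e₃ d₁ d₂ d₃ n p →
               Condition₂ e₁ e₂ e₃ d₁ d₂ d₃ n p
  necessary₂ {d₂ = d₂} {d₃} H x p∤d₁ p∣d₂ p∣d₃
    with squareFree-split {d₂} (Hypotheses.squareFree₂ H) (Signed.∣ᵤ⇒∣ p∣d₂)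
       | squareFree-split {d₃} (Hypotheses.squareFree₃ H) (Signed.∣ᵤ⇒∣ p∣d₃)
  necessary₂ {e₁} {e₂} {e₃} {d₁} {n = n} H x p∤d₁ p∣d₂ p∣d₃ | b₂ , refl , p∤b₂ | b₃ , refl , p∤b₃ =
    let (L₁ , L₂ , L₃) = legendre-case₂ p∤e₂ p∤e₃ p∤n′ (p∤d₁ ∘ Signed.∣⇒∣ᵤ) p∤b₂ p∤b₃ d₁b₂b₃-square
                           (subst (PrimitiveSolutionModP² e₁ e₂ e₃ d₁ (b₂ * P) (b₃ * P)) n≡n′p (solution-mod-p² x))
    in L₁ ,
       legendreOneFrac-p¹ (pull-n e₃) refl (p∤-* p∤e₃ p∤n′) p∤b₂ L₂ ,
       legendreOneFrac-p¹ (pull-n (- e₂)) refl (p∤-* (p∤-neg p∤e₂) p∤n′) p∤b₃ L₃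
    where
    open Hypotheses H
    pull-n : ∀ e → e * + n ≡ e * n′ * P
    pull-n e = trans (cong (e *_) n≡n′p) (sym (ℤ.*-assoc e n′ P))
    identity : ∀ d₁ b₂ b₃ P → d₁ * b₂ * b₃ * (P * P) ≡ d₁ * (b₂ * P) * (b₃ * P)
    identity = solve-∀
    d₁b₂b₃-square : IsSquare (d₁ * b₂ * b₃)
    d₁b₂b₃-square = p²-times-square {d₁ * b₂ * b₃} {proj₁ d₁d₂d₃-square}
      (trans (identity d₁ b₂ b₃ P) (proj₂ d₁d₂d₃-square))

  necessary : ∀ {e₁ e₂ e₃ d₁ d₂ d₃ n} → Hypotheses e₁ e₂ e₃ d₁ d₂ d₃ n →
              HasQpPoint e₁ e₂ e₃ d₁ d₂ d₃ n p → LocalConditions e₁ e₂ e₃ d₁ d₂ d₃ n p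
  necessary {e₁} {e₂} {e₃} {d₁} {d₂} {d₃} {n} H x = condition₁ , necessary₂ H x , condition₃ , condition₄
    where
    H′ : Hypotheses e₂ e₃ e₁ d₂ d₃ d₁ n
    H′ = rotate-hypotheses H
    H″ : Hypotheses e₃ e₁ e₂ d₃ d₁ d₂ n
    H″ = rotate-hypotheses H′
    x′ : HasQpPoint e₂ e₃ e₁ d₂ d₃ d₁ n p
    x′ = rotate {e₁} {e₂} {e₃} {d₁} {d₂} {d₃} x
    x″ : HasQpPoint e₃ e₁ e₂ d₃ d₁ d₂ n p
    x″ = rotate {e₂} {e₃} {e₁} {d₂} {d₃} {d₁} x′

    condition₁ : Condition₁ d₁ d₂ d₃ p
    condition₁ p∤d₁d₂d₃ =
      let (p∤d₁ , p∤d₂ , p∤d₃) = p∤-factors {d₁} {d₂} {d₃} (p∤d₁d₂d₃ ∘ Signed.∣⇒∣ᵤ)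
      in necessary₁ H x p∤d₁ p∤d₂ p∤d₃ , necessary₁ H′ x′ p∤d₂ p∤d₃ p∤d₁ , necessary₁ H″ x″ p∤d₃ p∤d₁ p∤d₂

    condition₃ : Condition₃ e₁ e₂ e₃ d₁ d₂ d₃ n p
    condition₃ p∣d₁ p∤d₂ p∣d₃ = let (L , F₃ , F₁) = necessary₂ H′ x′ p∤d₂ p∣d₃ p∣d₁ in F₁ , L , F₃

    condition₄ : Condition₄ e₁ e₂ e₃ d₁ d₂ d₃ n p
    condition₄ p∣d₁ p∣d₂ p∤d₃ = let (L , F₁ , F₂) = necessary₂ H″ x″ p∤d₃ p∣d₁ p∣d₂ in F₁ , F₂ , L

  module _ (p≢2 : p ≢ 2) where

    p∤2 : ¬ P ∣ₛ + 2
    p∤2 p∣2 = [ p≢1 , p≢2 ] (irreducible[2] (Signed.∣⇒∣ᵤ p∣2))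

    -- Newton's iteration x ↦ x − c (x² − a) with c ≡ (2x₀)⁻¹ mod p: every iterate stays
    -- ≡ x₀ mod p, so each step gains a factor p in x² − a.
    hensel : ∀ {a} → LegendreOne p a → SquareRoot a
    hensel {a} (p∤a , x₀ , p∣x₀²-a) = root , λ k → Signed.∣-trans (P^k∣P^suck k) (proj₁ (invariant k))
      where
      p∤2x₀ : ¬ P ∣ₛ + 2 * x₀
      p∤2x₀ = p∤-* p∤2 (p∤-root (p∤a ∘ Signed.∣⇒∣ᵤ) (Signed.∣ᵤ⇒∣ p∣x₀²-a))

      c : ℤ
      c = proj₁ (invertible p∤2x₀)

      x : ℕ → ℤ
      x zero = x₀
      x (suc k) = x k - c * (x k * x k - a)

      Invariant : ℕ → Set
      Invariant k = P^ suc k ∣ₛ x k * x k - a × P ∣ₛ x k - x₀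

      step : ∀ k → Invariant k → Invariant (suc k)
      step k (pᵏ⁺¹∣D , p∣x-x₀) =
        ∣-respˡ-≡ (sym (P^-suc (suc k))) (∣-respʳ-≡ (identity₁ (x k) a c)
          (Signed.∣m∣n⇒∣m+n (*-pres-∣ p∣1-2xc pᵏ⁺¹∣D) (Signed.∣n⇒∣m*n (c * c) (*-pres-∣ p∣D pᵏ⁺¹∣D)))) ,
        ∣-respʳ-≡ (identity₂ (x k) x₀ c a) (Signed.∣m∣n⇒∣m-n p∣x-x₀ (Signed.∣n⇒∣m*n c p∣D))
        where
        identity₁ : ∀ x a c → (+ 1 - + 2 * x * c) * (x * x - a) + c * c * ((x * x - a) * (x * x - a))
                              ≡ (x - c * (x * x - a)) * (x - c * (x * x - a)) - a
        identity₁ = solve-∀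
        identity₂ : ∀ x x₀ c a → x - x₀ - c * (x * x - a) ≡ x - c * (x * x - a) - x₀
        identity₂ = solve-∀
        identity₃ : ∀ x x₀ c → - (+ 2 * x₀ * c - + 1) - + 2 * c * (x - x₀) ≡ + 1 - + 2 * x * c
        identity₃ = solve-∀
        p∣D : P ∣ₛ x k * x k - a
        p∣D = Signed.∣-trans (P∣P^suck k) pᵏ⁺¹∣D
        p∣1-2xc : P ∣ₛ + 1 - + 2 * x k * c
        p∣1-2xc = ∣-respʳ-≡ (identity₃ (x k) x₀ c)
          (Signed.∣m∣n⇒∣m-n (Signed.∣m⇒∣-m (proj₂ (invertible p∤2x₀))) (Signed.∣n⇒∣m*n (+ 2 * c) p∣x-x₀))

      invariant : ∀ k → Invariant k
      invariant zero = ∣-respˡ-≡ (sym P^1) (Signed.∣ᵤ⇒∣ p∣x₀²-a) , ∣-≡0 (ℤ.+-inverseʳ x₀)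
      invariant (suc k) = step k (invariant k)

      root : ℤₚ p
      approx root = x
      coh root k = Signed.∣⇒∣ᵤ (∣-respʳ-≡ (identity (x k) c a)
        (Signed.∣m⇒∣-m (Signed.∣n⇒∣m*n c (Signed.∣-trans (P^k∣P^suck k) (proj₁ (invariant k))))))
        where
        identity : ∀ x c a → - (c * (x * x - a)) ≡ x - c * (x * x - a) - x
        identity = solve-∀

    point-of-case₁ : ∀ {e₁ e₂ e₃ d₁ d₂ d₃ n} →
      LegendreOne p d₁ × LegendreOne p d₂ × LegendreOne p d₃ → HasQpPoint e₁ e₂ e₃ d₁ d₂ d₃ n p
    point-of-case₁ {e₁} {e₂} {e₃} {d₁} {d₂} {d₃} {n} (L₁ , L₂ , L₃) =
      point-from-roots {e₁} {e₂} {e₃} {d₁} {d₂} {d₃} {n} (+ 0) (d₂ * d₃) (d₃ * d₁) (d₁ * d₂) u₁ u₂ u₃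
        (inj₂ (p∤-root {d₂ * d₃} (p∤-* {d₂} {d₃} (proj₁ L₂ ∘ Signed.∣⇒∣ᵤ) (proj₁ L₃ ∘ Signed.∣⇒∣ᵤ))
                                   (∣-respˡ-≡ P^1 (proj₂ u₁ 1))))
        (vanish e₁ (+ n) d₂ d₃ d₁) (vanish e₂ (+ n) d₃ d₁ d₂) (vanish e₃ (+ n) d₁ d₂ d₃)
      where
      u₁ : SquareRoot (d₂ * d₃)
      u₁ = hensel {d₂ * d₃} (legendreOne-* {d₂} {d₃} L₂ L₃)
      u₂ : SquareRoot (d₃ * d₁)
      u₂ = hensel {d₃ * d₁} (legendreOne-* {d₃} {d₁} L₃ L₁)
      u₃ : SquareRoot (d₁ * d₂)
      u₃ = hensel {d₁ * d₂} (legendreOne-* {d₁} {d₂} L₁ L₂)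
      vanish : ∀ e N a b c → e * N * + 0 * + 0 + a * (b * c) - b * (c * a) ≡ + 0
      vanish = solve-∀

    -- With e₃n = p^v₂ a₂, d₂ = p^v₂ b₂ and −e₂n = p^v₃ a₃, d₃ = p^v₃ b₃, the point is
    -- (b₂b₃ : 0 : b₃√(a₂b₂) : b₂√(a₃b₃)).
    point-of-case₂ : ∀ {e₁ e₂ e₃ d₁ d₂ d₃ n} → e₁ + e₂ + e₃ ≡ + 0 →
      LegendreOneFrac p (e₃ * + n) d₂ → LegendreOneFrac p (- e₂ * + n) d₃ → HasQpPoint e₁ e₂ e₃ d₁ d₂ d₃ n p
    point-of-case₂ {e₁} {e₂} {e₃} {d₁} {n = n} e-sum
      (v₂ , a₂ , b₂ , e₃n≡p^v₂a₂ , refl , _ , p∤b₂ , L₂) (v₃ , a₃ , b₃ , -e₂n≡p^v₃a₃ , refl , _ , p∤b₃ , L₃) =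
      point-from-roots {e₁} {e₂} {e₃} {d₁} {q₂ * b₂} {q₃ * b₃} {n}
        t (+ 0 * + 0) (a₂ * b₂ * (b₃ * b₃)) (a₃ * b₃ * (b₂ * b₂)) (constant-root (+ 0)) u₂ u₃
        (inj₁ (p∤-* {b₂} {b₃} (p∤b₂ ∘ Signed.∣⇒∣ᵤ) (p∤b₃ ∘ Signed.∣⇒∣ᵤ))) vanish₁ vanish₂ vanish₃
      where
      q₂ q₃ t : ℤ
      q₂ = P^ v₂
      q₃ = P^ v₃
      t = b₂ * b₃
      u₂ : SquareRoot (a₂ * b₂ * (b₃ * b₃))
      u₂ = hensel {a₂ * b₂ * (b₃ * b₃)}
        (legendreOne-* {a₂ * b₂} {b₃ * b₃} L₂ (legendreOne-square {b₃} (p∤b₃ ∘ Signed.∣⇒∣ᵤ)))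
      u₃ : SquareRoot (a₃ * b₃ * (b₂ * b₂))
      u₃ = hensel {a₃ * b₃ * (b₂ * b₂)}
        (legendreOne-* {a₃ * b₃} {b₂ * b₂} L₃ (legendreOne-square {b₂} (p∤b₂ ∘ Signed.∣⇒∣ᵤ)))
      identity₁ : ∀ e₁ e₂ e₃ N q₂ q₃ a₂ a₃ b₂ b₃ →
        e₁ * N * (b₂ * b₃) * (b₂ * b₃) + q₂ * b₂ * (a₂ * b₂ * (b₃ * b₃)) - q₃ * b₃ * (a₃ * b₃ * (b₂ * b₂))
        ≡ (e₁ + e₂ + e₃) * (N * (b₂ * b₃ * (b₂ * b₃))) - (e₃ * N - q₂ * a₂) * (b₂ * b₃ * (b₂ * b₃))
          + (- e₂ * N - q₃ * a₃) * (b₂ * b₃ * (b₂ * b₃))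
      identity₁ = solve-∀
      identity₂ : ∀ e₂ N q₃ a₃ b₂ b₃ d₁ →
        e₂ * N * (b₂ * b₃) * (b₂ * b₃) + q₃ * b₃ * (a₃ * b₃ * (b₂ * b₂)) - d₁ * (+ 0 * + 0)
        ≡ (- e₂ * N - q₃ * a₃) * - (b₂ * b₃ * (b₂ * b₃))
      identity₂ = solve-∀
      identity₃ : ∀ e₃ N q₂ a₂ b₂ b₃ d₁ →
        e₃ * N * (b₂ * b₃) * (b₂ * b₃) + d₁ * (+ 0 * + 0) - q₂ * b₂ * (a₂ * b₂ * (b₃ * b₃))
        ≡ (e₃ * N - q₂ * a₂) * (b₂ * b₃ * (b₂ * b₃))
      identity₃ = solve-∀
      vanish₁ : e₁ * + n * t * t + q₂ * b₂ * (a₂ * b₂ * (b₃ * b₃)) - q₃ * b₃ * (a₃ * b₃ * (b₂ * b₂)) ≡ + 0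
      vanish₁ = trans (identity₁ e₁ e₂ e₃ (+ n) q₂ q₃ a₂ a₃ b₂ b₃)
        (cong₂ _+_ (cong₂ _-_ (cong (_* (+ n * (t * t))) e-sum) ([x-y]*z≡0 (t * t) e₃n≡p^v₂a₂))
                   ([x-y]*z≡0 (t * t) -e₂n≡p^v₃a₃))
      vanish₂ : e₂ * + n * t * t + q₃ * b₃ * (a₃ * b₃ * (b₂ * b₂)) - d₁ * (+ 0 * + 0) ≡ + 0
      vanish₂ = trans (identity₂ e₂ (+ n) q₃ a₃ b₂ b₃ d₁) ([x-y]*z≡0 (- (t * t)) -e₂n≡p^v₃a₃)
      vanish₃ : e₃ * + n * t * t + d₁ * (+ 0 * + 0) - q₂ * b₂ * (a₂ * b₂ * (b₃ * b₃)) ≡ + 0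
      vanish₃ = trans (identity₃ e₃ (+ n) q₂ a₂ b₂ b₃ d₁) ([x-y]*z≡0 (t * t) e₃n≡p^v₂a₂)

    sufficient : ∀ {e₁ e₂ e₃ d₁ d₂ d₃ n} → Hypotheses e₁ e₂ e₃ d₁ d₂ d₃ n →
                 LocalConditions e₁ e₂ e₃ d₁ d₂ d₃ n p → HasQpPoint e₁ e₂ e₃ d₁ d₂ d₃ n p
    sufficient {e₁} {e₂} {e₃} {d₁} {d₂} {d₃} {n} H (condition₁ , condition₂ , condition₃ , condition₄) =
      by-cases (P ∣? d₁) (P ∣? d₂) (P ∣? d₃)
      where
      open Hypotheses
      H′ : Hypotheses e₂ e₃ e₁ d₂ d₃ d₁ n
      H′ = rotate-hypotheses H
      H″ : Hypotheses e₃ e₁ e₂ d₃ d₁ d₂ n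
      H″ = rotate-hypotheses H′
      by-cases : Dec (P ∣ₛ d₁) → Dec (P ∣ₛ d₂) → Dec (P ∣ₛ d₃) → HasQpPoint e₁ e₂ e₃ d₁ d₂ d₃ n p
      by-cases (no p∤d₁) (no p∤d₂) (no p∤d₃) =
        point-of-case₁ {e₁} {e₂} {e₃} (condition₁ (p∤-* (p∤-* p∤d₁ p∤d₂) p∤d₃ ∘ Signed.∣ᵤ⇒∣))
      by-cases (no p∤d₁) (yes p∣d₂) (yes p∣d₃) =
        let (_ , F₂ , F₃) = condition₂ (p∤d₁ ∘ Signed.∣ᵤ⇒∣) (Signed.∣⇒∣ᵤ p∣d₂) (Signed.∣⇒∣ᵤ p∣d₃)
        in point-of-case₂ {e₁} {e₂} {e₃} {d₁} {d₂} {d₃} {n} (e₁+e₂+e₃≡0 H) F₂ F₃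
      by-cases (yes p∣d₁) (no p∤d₂) (yes p∣d₃) =
        let (F₁ , _ , F₃) = condition₃ (Signed.∣⇒∣ᵤ p∣d₁) (p∤d₂ ∘ Signed.∣ᵤ⇒∣) (Signed.∣⇒∣ᵤ p∣d₃)
        in rotate {e₃} {e₁} {e₂} {d₃} {d₁} {d₂} (rotate {e₂} {e₃} {e₁} {d₂} {d₃} {d₁}
             (point-of-case₂ {e₂} {e₃} {e₁} {d₂} {d₃} {d₁} {n} (e₁+e₂+e₃≡0 H′) F₃ F₁))
      by-cases (yes p∣d₁) (yes p∣d₂) (no p∤d₃) =
        let (F₁ , F₂ , _) = condition₄ (Signed.∣⇒∣ᵤ p∣d₁) (Signed.∣⇒∣ᵤ p∣d₂) (p∤d₃ ∘ Signed.∣ᵤ⇒∣)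
        in rotate {e₃} {e₁} {e₂} {d₃} {d₁} {d₂}
             (point-of-case₂ {e₃} {e₁} {e₂} {d₃} {d₁} {d₂} {n} (e₁+e₂+e₃≡0 H″) F₁ F₂)
      by-cases (yes p∣d₁) (no p∤d₂) (no p∤d₃) =
        ⊥-elim (¬square-p∣one (squareFree₁ H) p∣d₁ p∤d₂ p∤d₃ (d₁d₂d₃-square H))
      by-cases (no p∤d₁) (yes p∣d₂) (no p∤d₃) =
        ⊥-elim (¬square-p∣one (squareFree₁ H′) p∣d₂ p∤d₃ p∤d₁ (d₁d₂d₃-square H′))
      by-cases (no p∤d₁) (no p∤d₂) (yes p∣d₃) =
        ⊥-elim (¬square-p∣one (squareFree₁ H″) p∣d₃ p∤d₁ p∤d₂ (d₁d₂d₃-square H″))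
      by-cases (yes p∣d₁) (yes p∣d₂) (yes p∣d₃) =
        ⊥-elim (¬square-p∣all (squareFree₁ H) (squareFree₂ H) (squareFree₃ H) p∣d₁ p∣d₂ p∣d₃ (d₁d₂d₃-square H))

lemma2p5 : (e₁ e₂ e₃ : ℤ) → e₁ ≢ + 0 → e₂ ≢ + 0 → e₃ ≢ + 0 → e₁ + e₂ + e₃ ≡ + 0 →
    (d₁ d₂ d₃ : ℤ) → SquareFree d₁ → SquareFree d₂ → SquareFree d₃ → IsSquare (d₁ * d₂ * d₃) →
    (n : ℕ) → 0 ℕ.< n → SquareFree (+ n) → Coprime n ∣ e₁ * e₂ * e₃ ∣ →
    (p : ℕ) → Prime p → p ≢ 2 → p ∣ℕ n →
    HasQpPoint e₁ e₂ e₃ d₁ d₂ d₃ n p ⇔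
      (((¬ (+ p ∣ d₁ * d₂ * d₃)) →
          LegendreOne p d₁ × LegendreOne p d₂ × LegendreOne p d₃)
      × ((¬ (+ p ∣ d₁)) → + p ∣ d₂ → + p ∣ d₃ →
          LegendreOne p (- e₂ * e₃ * d₁) × LegendreOneFrac p (e₃ * + n) d₂ × LegendreOneFrac p (- e₂ * + n) d₃)
      × (+ p ∣ d₁ → (¬ (+ p ∣ d₂)) → + p ∣ d₃ →
          LegendreOneFrac p (- e₃ * + n) d₁ × LegendreOne p (- e₃ * e₁ * d₂) × LegendreOneFrac p (e₁ * + n) d₃)
      × (+ p ∣ d₁ → + p ∣ d₂ → (¬ (+ p ∣ d₃)) →
          LegendreOneFrac p (e₂ * + n) d₁ × LegendreOneFrac p (- e₁ * + n) d₂ × LegendreOne p (- e₁ * e₂ * d₃)))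
lemma2p5 e₁ e₂ e₃ _ _ _ e-sum d₁ d₂ d₃ sf₁ sf₂ sf₃ square n _ sf-n coprime p p-prime p≢2 p∣n =
  mk⇔ (necessary p-prime H) (sufficient p-prime p≢2 H)
  where
  H : Hypotheses p-prime e₁ e₂ e₃ d₁ d₂ d₃ n
  H = hypotheses p-prime e-sum sf₁ sf₂ sf₃ square sf-n coprime p∣n
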